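{- Let $s\geq2$ and $N\geq1$ be integers. Then $$\widetilde{r}(s,2N)\geq N\cdot r(2s-1,N).$$ More precisely, if $A\subset\{1,2,\ldots,N\}$ contains no arithmetic progression of length $2s-1$, then the set $$\Theta(A)=\{(a+m,m):a\in A,\ m=1,2,\ldots,N\}\subset\{1,2,\ldots,2N\}^2$$ contains no $s\times s$ axes-parallel grid and has cardinality $N|A|$.
   Context: For integers $k\geq 3$ and $N\geq1$, $r(k,N)$ denotes the maximal cardinality of a subset of $\{1,2,\ldots,N\}$ containing no $k$-term arithmetic progression $\{a,a+d,\ldots,a+(k-1)d\}$ with $d\geq1$. For integers $s\geq2$ and $M\geq1$, $\widetilde{r}(s,M)$ denotes the maximal cardinality of a subset of $\{1,2,\ldots,M\}^2$ containing no $s\times s$ axes-parallel grid, where an $s\times s$ axes-parallel grid is a set $\{(x+il,\,y+jl): i,j\in\{0,1,\ldots,s-1\}\}$ with integers $x,y$ and $l\geq1$. -}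

module Defs where

open import Data.Nat using (ℕ; suc; _+_; _*_; _≤_)
open import Data.Product using (Σ; _×_; _,_; proj₁; proj₂)
open import Data.List using (List; length; map; concatMap; upTo)
open import Data.List.Relation.Unary.All using (All)
open import Data.List.Relation.Unary.Unique.Propositional using (Unique)
open import Data.List.Membership.Propositional using (_∈_)
open import Relation.Binary.PropositionalEquality using (_≡_)
open import Relation.Nullary using (¬_)

-- Finite sets are represented as duplicate-free lists; cardinality = length.

InRange : ℕ → ℕ → Set
InRange N x = 1 ≤ x × x ≤ N

APFree : ℕ → List ℕ → Set
APFree k A = ∀ a d → 1 ≤ d → ¬ (∀ i → suc i ≤ k → a + i * d ∈ A)

GridFree : ℕ → List (ℕ × ℕ) → Set
GridFree s P = ∀ x y l → 1 ≤ l →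
  ¬ (∀ i j → suc i ≤ s → suc j ≤ s → (x + i * l , y + j * l) ∈ P)

IsAPFreeSet : ℕ → ℕ → List ℕ → Set
IsAPFreeSet k N A = Unique A × All (InRange N) A × APFree k A

IsGridFreeSet : ℕ → ℕ → List (ℕ × ℕ) → Set
IsGridFreeSet s M P =
  Unique P × All (λ p → InRange M (proj₁ p) × InRange M (proj₂ p)) P × GridFree s P

IsR : ℕ → ℕ → ℕ → Set
IsR k N m = (Σ (List ℕ) λ A → IsAPFreeSet k N A × length A ≡ m)
          × (∀ A → IsAPFreeSet k N A → length A ≤ m)

IsRTilde : ℕ → ℕ → ℕ → Set
IsRTilde s M m = (Σ (List (ℕ × ℕ)) λ P → IsGridFreeSet s M P × length P ≡ m)
               × (∀ P → IsGridFreeSet s M P → length P ≤ m)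

range1 : ℕ → List ℕ
range1 N = map suc (upTo N)

Θ : ℕ → List ℕ → List (ℕ × ℕ)
Θ N A = concatMap (λ a → map (λ m → (a + m , m)) (range1 N)) A

module Submission where

-- A point (u , v) lies in Θ(A) exactly when its "difference"
-- u ∸ v is an element of A (and 1 ≤ v ≤ N).  Along an s×s grid with corner
-- (x , y) and step l the difference of the node (i , j) is x - y + (i - j)·l,
-- so the 2s-1 possible values of i - j ∈ {-(s-1), …, s-1} give a
-- (2s-1)-term progression of step l inside A.  Concretely, writing s = 1 + s'
-- and a₀ for the difference at the node (0 , s'), every t ≤ 2s' splits as
-- i + s' = t + j with i , j ≤ s', and the difference at (i , j) is a₀ + t·l.

open import Defs
open import Data.Nat using (ℕ; suc; z≤n; s≤s; _+_; _*_; _∸_; _≤_; _≤?_)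
open import Data.Nat.Properties
open import Data.Nat.Tactic.RingSolver using (solve-∀)
open import Data.Product using (∃-syntax; _×_; _,_; proj₁; proj₂)
open import Data.List using (List; []; _∷_; _++_; length; map; upTo)
open import Data.List.Properties using (length-++; length-map; length-upTo)
open import Data.List.Relation.Unary.All using (All)
import Data.List.Relation.Unary.All as All
open import Data.List.Relation.Unary.AllPairs using ([]; _∷_)
open import Data.List.Relation.Unary.Unique.Propositional using (Unique)
open import Data.List.Relation.Unary.Unique.Propositional.Properties using (map⁺; ++⁺; upTo⁺)
open import Data.List.Membership.Propositional using (_∈_; find)
open import Data.List.Membership.Propositional.Properties
  using (∈-map⁻; ∈-upTo⁻; ∈-concatMap⁻)
open import Relation.Binary.PropositionalEquality
open import Relation.Nullary using (¬_; yes; no)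

diagonal : ℕ → ℕ → List (ℕ × ℕ)
diagonal N a = map (λ m → (a + m , m)) (range1 N)

∈Θ⁻ : ∀ N A {u v} → (u , v) ∈ Θ N A →
      ∃[ a ] a ∈ A × InRange N v × u ≡ a + v
∈Θ⁻ N A p∈
  with a , a∈A , q ← find (∈-concatMap⁻ (diagonal N) {xs = A} p∈)
  with m , m∈ , refl ← ∈-map⁻ (λ m → (a + m , m)) q
  with k , k∈ , refl ← ∈-map⁻ suc m∈
  = a , a∈A , (s≤s z≤n , ∈-upTo⁻ k∈) , refl

length-Θ : ∀ N A → length (Θ N A) ≡ N * length A
length-Θ N [] = sym (*-zeroʳ N)
length-Θ N (a ∷ A) = begin
  length (diagonal N a ++ Θ N A)            ≡⟨ length-++ (diagonal N a) ⟩
  length (diagonal N a) + length (Θ N A)    ≡⟨ cong₂ _+_ length-diagonal (length-Θ N A) ⟩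
  N + N * length A                          ≡⟨ sym (*-suc N (length A)) ⟩
  N * suc (length A)                        ∎
  where
  open ≡-Reasoning
  length-diagonal : length (diagonal N a) ≡ N
  length-diagonal = begin
    length (diagonal N a)       ≡⟨ length-map _ (range1 N) ⟩
    length (map suc (upTo N))   ≡⟨ length-map suc (upTo N) ⟩
    length (upTo N)             ≡⟨ length-upTo N ⟩
    N                           ∎

Θ-inRange : ∀ N A → All (InRange N) A →
            All (λ p → InRange (2 * N) (proj₁ p) × InRange (2 * N) (proj₂ p)) (Θ N A)
Θ-inRange N A A⊆[1,N] = All.tabulate inRange
  where
  N≤2N : N ≤ 2 * N
  N≤2N = m≤n*m N 2
  N+N≡2N : N + N ≡ 2 * N
  N+N≡2N = cong (N +_) (sym (+-identityʳ N))
  inRange : ∀ {p} → p ∈ Θ N A → InRange (2 * N) (proj₁ p) × InRange (2 * N) (proj₂ p)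
  inRange {u , v} p∈ with a , a∈A , (1≤v , v≤N) , refl ← ∈Θ⁻ N A p∈
    with 1≤a , a≤N ← All.lookup A⊆[1,N] a∈A
    = (≤-trans 1≤a (m≤m+n a v) , subst (a + v ≤_) N+N≡2N (+-mono-≤ a≤N v≤N))
    , (1≤v , ≤-trans v≤N N≤2N)

-- Θ(A) has no repeated points: a diagonal is injective in m, and distinct
-- elements of A give disjoint diagonals (the difference u ∸ v recovers a).
Θ-unique : ∀ N A → Unique A → Unique (Θ N A)
Θ-unique N [] [] = []
Θ-unique N (a ∷ A) (a∉A ∷ uniqueA) =
  ++⁺ (map⁺ (cong proj₂) (map⁺ suc-injective (upTo⁺ N))) (Θ-unique N A uniqueA) disjoint
  where
  disjoint : ∀ {p} → ¬ (p ∈ diagonal N a × p ∈ Θ N A)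
  disjoint (p∈diag , p∈Θ)
    with m , _ , refl ← ∈-map⁻ (λ m → (a + m , m)) p∈diag
    with b , b∈A , _ , a+m≡b+m ← ∈Θ⁻ N A p∈Θ
    = All.lookup a∉A b∈A (+-cancelʳ-≡ m a b a+m≡b+m)

-- Index splitting: every t ≤ s' + s' is t = i + s' - j with i , j ≤ s'.
-- (Take i = 0 when t ≤ s', and j = 0 otherwise.)
split-index : ∀ s' t → t ≤ s' + s' →
              ∃[ i ] ∃[ j ] i ≤ s' × j ≤ s' × i + s' ≡ t + j
split-index s' t t≤2s' with t ≤? s'
... | yes t≤s' = 0 , s' ∸ t , z≤n , m∸n≤m s' t , sym (m+[n∸m]≡n t≤s')
... | no  t≰s' = t ∸ s' , 0 , t∸s'≤s' , z≤n , trans (m∸n+n≡m s'≤t) (sym (+-identityʳ t))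
  where
  s'≤t : s' ≤ t
  s'≤t = <⇒≤ (≰⇒> t≰s')
  t∸s'≤s' : t ∸ s' ≤ s'
  t∸s'≤s' = subst (t ∸ s' ≤_) (m+n∸n≡m s' s') (∸-monoˡ-≤ s' t≤2s')

grid-difference : ∀ x y l s' i j t a₀ a → i + s' ≡ t + j →
                  x + 0 * l ≡ a₀ + (y + s' * l) →
                  x + i * l ≡ a + (y + j * l) →
                  a ≡ a₀ + t * l
grid-difference x y l s' i j t a₀ a split corner node =
  +-cancelʳ-≡ (y + j * l) a (a₀ + t * l) (begin
    a + (y + j * l)                ≡⟨ sym node ⟩
    x + i * l                      ≡⟨ cong (λ z → z + i * l) (sym (+-identityʳ x)) ⟩
    x + 0 * l + i * l              ≡⟨ cong (_+ i * l) corner ⟩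
    a₀ + (y + s' * l) + i * l      ≡⟨ regroup a₀ y l s' i ⟩
    a₀ + y + (i + s') * l          ≡⟨ cong (λ k → a₀ + y + k * l) split ⟩
    a₀ + y + (t + j) * l           ≡⟨ regroup′ a₀ y l t j ⟩
    a₀ + t * l + (y + j * l)       ∎)
  where
  open ≡-Reasoning
  regroup : ∀ a₀ y l s' i → a₀ + (y + s' * l) + i * l ≡ a₀ + y + (i + s') * l
  regroup = solve-∀
  regroup′ : ∀ a₀ y l t j → a₀ + y + (t + j) * l ≡ a₀ + t * l + (y + j * l)
  regroup′ = solve-∀

progression-length : ∀ s' → 2 * suc s' ∸ 1 ≡ suc (s' + s')
progression-length s' = trans (+-suc s' (s' + 0)) (cong (λ k → suc (s' + k)) (+-identityʳ s'))

Θ-gridFree : ∀ s' N A → APFree (2 * suc s' ∸ 1) A → GridFree (suc s') (Θ N A)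
Θ-gridFree s' N A apFree x y l 1≤l grid
  with a₀ , a₀∈A , _ , corner ← ∈Θ⁻ N A (grid 0 s' (s≤s z≤n) ≤-refl)
  = apFree a₀ l 1≤l progression
  where
  progression : ∀ t → suc t ≤ 2 * suc s' ∸ 1 → a₀ + t * l ∈ A
  progression t t<2s-1
    with i , j , i≤s' , j≤s' , split ← split-index s' t
           (≤-pred (subst (suc t ≤_) (progression-length s') t<2s-1))
    with a , a∈A , _ , node ← ∈Θ⁻ N A (grid i j (s≤s i≤s') (s≤s j≤s'))
    = subst (_∈ A) (grid-difference x y l s' i j t a₀ a split corner node) a∈A

mainTheorem2 : ∀ (s N : ℕ) → 2 ≤ s → 1 ≤ N →
    (∀ r rt → IsR (2 * s ∸ 1) N r → IsRTilde s (2 * N) rt → N * r ≤ rt)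
    × (∀ (A : List ℕ) → IsAPFreeSet (2 * s ∸ 1) N A →
         IsGridFreeSet s (2 * N) (Θ N A) × length (Θ N A) ≡ N * length A)
mainTheorem2 (suc s') N _ _ = lowerBound , construction
  where
  construction : ∀ A → IsAPFreeSet (2 * suc s' ∸ 1) N A →
                 IsGridFreeSet (suc s') (2 * N) (Θ N A) × length (Θ N A) ≡ N * length A
  construction A (uniqueA , A⊆[1,N] , apFree) =
    (Θ-unique N A uniqueA , Θ-inRange N A A⊆[1,N] , Θ-gridFree s' N A apFree) , length-Θ N A
  lowerBound : ∀ r rt → IsR (2 * suc s' ∸ 1) N r → IsRTilde (suc s') (2 * N) rt → N * r ≤ rt
  lowerBound r rt ((A , A-apFree , refl) , _) (_ , rt-maximal) =
    subst (_≤ rt) (length-Θ N A) (rt-maximal (Θ N A) (proj₁ (construction A A-apFree)))
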